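{- Let $n\ge1$ and let $p$ be a Schröder $(n-1)$-path. Then: (1) if $p$ has exactly $k$ valleys, then $\phi(p)$ has exactly $k$ late zeros; (2) if the valley word of $p$ contains exactly $k$ letters $U$ (equivalently, $k$ is the number of up steps of $p$ minus the number of valleys), then $\phi(p)$ has exactly $k$ distinct nonzero values; (3) if $p$ has exactly $k$ flat steps at height $0$, then $\phi(p)$ begins with exactly $k+1$ zeros (i.e. $e_1=\cdots=e_{k+1}=0$ and either $k+1=n$ or $e_{k+2}\neq0$).
   Context: An inversion sequence of length $n$ is an integer sequence $e=(e_1,\ldots,e_n)$ with $0 \le e_i < i$ for all $i$; $\mathbf{I}_n(021)$ is the set of those with no $i<j<k$ such that $e_i<e_k<e_j$. A Schröder $m$-path is a lattice path from $(0,0)$ to $(2m,0)$ never going below the $x$-axis with steps $U=(1,1)$, $D=(1,-1)$, $F=(2,0)$, written as a word in $U,D,F$. A valley is an occurrence of $D$ immediately followed by $U$; a flat step at height $0$ is an $F$ step lying on the $x$-axis. The valley word of $p$ is obtained by replacing every occurrence of $DU$ by the letter $V$. The map $\phi$ from Schröder $(n-1)$-paths to $\mathbf{I}_n(021)$ is defined as follows. Maintain words (blocks) $\mathbf{b}_0,\mathbf{b}_1,\ldots,\mathbf{b}_{n-1}$, initially $\mathbf{b}_0=(0)$ and all others empty, and a stack $M$, initially $M=(0)$; the current sequence $e$ is always the concatenation $\mathbf{b}_0\mathbf{b}_1\cdots\mathbf{b}_{n-1}$. Read the valley word of $p$ from left to right: on $U$, let $\ell$ be the current length of $e$, set $\mathbf{b}_\ell=(\ell)$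 and push $\ell$ onto $M$; on $D$, delete the last entry of $M$; on $V$, letting $j$ be the last entry of $M$, append $0$ to the end of $\mathbf{b}_j$; on $F$, letting $j$ be the last entry of $M$, append $j$ to the end of $\mathbf{b}_j$. Then $\phi(p)$ is the final concatenation $\mathbf{b}_0\cdots\mathbf{b}_{n-1}$, which lies in $\mathbf{I}_n(021)$ (and $\phi$ is a bijection). For $e\in\mathbf{I}_n$, a late zero is an index $i$ with $e_i=0$ such that $e_h\neq0$ for some $h<i$. -}

module Defs where

open import Data.Nat using (ℕ; zero; suc; _+_; _*_; _≟_)
open import Data.Bool using (Bool; true; false)
open import Data.List using (List; []; _∷_; _++_; [_]; length; upTo; concatMap; filter; deduplicate)
open import Data.Maybe using (Maybe; just; nothing)
open import Relation.Nullary using (¬?; yes; no)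
open import Relation.Binary.PropositionalEquality using (_≡_)
open import Data.Product using (_×_)

-- Steps of a Schröder path: U = (1,1), D = (1,-1), F = (2,0)
data Step : Set where
  U D F : Step

-- height tracking: final height starting from height h, or nothing if the
-- path goes below the x-axis
walk : ℕ → List Step → Maybe ℕ
walk h [] = just h
walk h (U ∷ s) = walk (suc h) s
walk zero (D ∷ s) = nothing
walk (suc h) (D ∷ s) = walk h s
walk h (F ∷ s) = walk h s

width : List Step → ℕ
width [] = 0
width (U ∷ s) = suc (width s)
width (D ∷ s) = suc (width s)
width (F ∷ s) = 2 + width s

IsSchroeder : ℕ → List Step → Set
IsSchroeder m p = (walk 0 p ≡ just 0) × (width p ≡ 2 * m)

valleys : List Step → ℕ
valleys (D ∷ U ∷ s) = suc (valleys (U ∷ s))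
valleys (_ ∷ s) = valleys s
valleys [] = 0

flats0From : ℕ → List Step → ℕ
flats0From h [] = 0
flats0From h (U ∷ s) = flats0From (suc h) s
flats0From zero (D ∷ s) = flats0From zero s
flats0From (suc h) (D ∷ s) = flats0From h s
flats0From zero (F ∷ s) = suc (flats0From zero s)
flats0From (suc h) (F ∷ s) = flats0From (suc h) s

flats0 : List Step → ℕ
flats0 = flats0From 0

data VLetter : Set where
  vU vD vV vF : VLetter

valleyWord : List Step → List VLetter
valleyWord (D ∷ U ∷ s) = vV ∷ valleyWord s
valleyWord (U ∷ s) = vU ∷ valleyWord s
valleyWord (D ∷ s) = vD ∷ valleyWord s
valleyWord (F ∷ s) = vF ∷ valleyWord s
valleyWord [] = []

countU : List VLetter → ℕ
countU [] = 0
countU (vU ∷ w) = suc (countU w)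
countU (_ ∷ w) = countU w

-- The map φ.  Blocks b_0, b_1, ... are a function ℕ → List ℕ; the current
-- sequence is b_0 b_1 ⋯ b_{n-1}; the stack M is a list whose head is its
-- last entry.
Blocks : Set
Blocks = ℕ → List ℕ

concatBlocks : ℕ → Blocks → List ℕ
concatBlocks n b = concatMap b (upTo n)

setBlock : ℕ → List ℕ → Blocks → Blocks
setBlock j w b i with i ≟ j
... | yes _ = w
... | no _ = b i

appendBlock : ℕ → ℕ → Blocks → Blocks
appendBlock j x b = setBlock j (b j ++ [ x ]) b

top : List ℕ → ℕ
top [] = 0
top (j ∷ _) = j

pop : List ℕ → List ℕ
pop [] = []
pop (_ ∷ M) = M

phiStep : ℕ → VLetter → Blocks → List ℕ → Blocks × List ℕ
phiStep n vU b M = let ℓ = length (concatBlocks n b) in setBlock ℓ [ ℓ ] b Data.Product., (ℓ ∷ M)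
phiStep n vD b M = b Data.Product., pop M
phiStep n vV b M = appendBlock (top M) 0 b Data.Product., M
phiStep n vF b M = appendBlock (top M) (top M) b Data.Product., M

phiRun : ℕ → List VLetter → Blocks → List ℕ → Blocks
phiRun n [] b M = b
phiRun n (c ∷ w) b M with phiStep n c b M
... | b' Data.Product., M' = phiRun n w b' M'

initBlocks : Blocks
initBlocks zero = 0 ∷ []
initBlocks (suc _) = []

-- φ : Schröder (n-1)-paths → I_n(021)
phi : ℕ → List Step → List ℕ
phi n p = concatBlocks n (phiRun n (valleyWord p) initBlocks (0 ∷ []))

-- late zeros: entries e_i = 0 preceded by some nonzero entry;
-- the Bool records whether a nonzero entry has been seen
lateZerosFrom : Bool → List ℕ → ℕ
lateZerosFrom _ [] = 0
lateZerosFrom false (zero ∷ e) = lateZerosFrom false e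
lateZerosFrom true (zero ∷ e) = suc (lateZerosFrom true e)
lateZerosFrom _ (suc _ ∷ e) = lateZerosFrom true e

lateZeros : List ℕ → ℕ
lateZeros = lateZerosFrom false

distinctNonzero : List ℕ → ℕ
distinctNonzero e = length (deduplicate _≟_ (filter (λ x → ¬? (x ≟ 0)) e))

-- Write n = n' + 1.  Running φ on a Schröder n'-path keeps the
-- blocks in a rigid shape: b₀ is a run of zeros (one more than the axis flat
-- steps read so far), and every positive block b_i is either empty or is i
-- followed by entries from {0, i}.  Each letter other than D adds exactly one
-- entry, U opens a fresh block at the current length, V appends a zero and F a
-- copy of the stack top to an open block.  Hence, at the end, φ(p) is
-- 0^{f+1} followed by the positive blocks, the late zeros are the zeros inside
-- positive blocks (one per valley), and the distinct nonzero values are the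
-- indices of the nonempty positive blocks (one per U of the valley word).
module Submission where

open import Defs
open import Data.Nat using (ℕ; suc; _≤_; _∸_)
open import Data.List using (List; _∷_; take; drop; replicate)
open import Data.Product using (_×_; Σ)
open import Data.Sum using (_⊎_)
open import Relation.Binary.PropositionalEquality using (_≡_; _≢_)

open import Data.Nat using (zero; _+_; _*_; _<_; _≟_; z≤n; s≤s)
open import Data.Nat.Properties
  using (+-suc; +-comm; +-assoc; +-identityʳ; *-cancelˡ-≡; suc-injective; <-irrefl; <⇒≢; >⇒≢;
         <⇒≤; ≰⇒>; m≤n⇒m<n∨m≡n; ≤-refl; <-trans; <-≤-trans; m<n⇒m<1+n; m<m+n)
open import Data.List using ([]; _++_; [_]; length; upTo; applyUpTo; concatMap; filter; deduplicate)
open import Data.List.Properties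
  using (length-++; length-replicate; ++-identityʳ; filter-++; filter-reject; filter-idem; filter-all)
open import Data.List.Relation.Unary.All using (All; []; _∷_) renaming (map to mapAll)
open import Data.List.Relation.Unary.All.Properties using (++⁺; filter⁺; deduplicate⁺)
open import Data.Product using (_,_)
open import Data.Sum using (inj₁; inj₂)
open import Data.Bool using (true; false)
open import Data.Maybe using (just)
open import Data.Empty using (⊥-elim)
open import Relation.Nullary using (¬_; ¬?; yes; no)
open import Relation.Binary.PropositionalEquality using (refl; sym; trans; cong; cong₂; subst; module ≡-Reasoning)
open import Function using (_∘_)

-- Index ranges and sums of block statistics

range : ℕ → ℕ → List ℕ
range s zero = []
range s (suc m) = s ∷ range (suc s) m

applyUpTo-shift : ∀ m (f : ℕ → ℕ) s → (∀ i → f i ≡ s + i) → applyUpTo f m ≡ range s m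
applyUpTo-shift zero f s f≗ = refl
applyUpTo-shift (suc m) f s f≗ =
  cong₂ _∷_ (trans (f≗ 0) (+-identityʳ s))
            (applyUpTo-shift m (f ∘ suc) (suc s) (λ i → trans (f≗ (suc i)) (+-suc s i)))

upTo≡range : ∀ m → upTo m ≡ range 0 m
upTo≡range m = applyUpTo-shift m (λ i → i) 0 (λ i → refl)

concatBlocks-suc : ∀ n' b → concatBlocks (suc n') b ≡ b 0 ++ concatMap b (range 1 n')
concatBlocks-suc n' b = cong (concatMap b) (upTo≡range (suc n'))

blockSum : (List ℕ → ℕ) → Blocks → ℕ → ℕ → ℕ
blockSum g b s zero = 0
blockSum g b s (suc m) = g (b s) + blockSum g b (suc s) m

length-concatMap : ∀ b s m → length (concatMap b (range s m)) ≡ blockSum length b s m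
length-concatMap b s zero = refl
length-concatMap b s (suc m) =
  trans (length-++ (b s)) (cong (length (b s) +_) (length-concatMap b (suc s) m))

length-concatBlocks : ∀ n b → length (concatBlocks n b) ≡ blockSum length b 0 n
length-concatBlocks n b = trans (cong (length ∘ concatMap b) (upTo≡range n)) (length-concatMap b 0 n)

setBlock-hit : ∀ j w b → setBlock j w b j ≡ w
setBlock-hit j w b with j ≟ j
... | yes _ = refl
... | no j≢j = ⊥-elim (j≢j refl)

setBlock-miss : ∀ {i j} w b → i ≢ j → setBlock j w b i ≡ b i
setBlock-miss {i} {j} w b i≢j with i ≟ j
... | yes i≡j = ⊥-elim (i≢j i≡j)
... | no _ = refl

Grows : Blocks → Blocks → Set
Grows b b' = ∀ i → b i ≢ [] → b' i ≢ []

setBlock-grows : ∀ j w b → w ≢ [] → Grows b (setBlock j w b)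
setBlock-grows j w b w≢[] i bi≢[] with i ≟ j
... | yes refl = w≢[]
... | no _ = bi≢[]

appendBlock-grows : ∀ j x b → Grows b (appendBlock j x b)
appendBlock-grows j x b = setBlock-grows j (b j ++ [ x ]) b (nonempty (b j))
  where
  nonempty : ∀ u → u ++ [ x ] ≢ []
  nonempty [] ()
  nonempty (_ ∷ _) ()

blockSum-setBlock-below : ∀ g b j w s m → j < s → blockSum g (setBlock j w b) s m ≡ blockSum g b s m
blockSum-setBlock-below g b j w s zero _ = refl
blockSum-setBlock-below g b j w s (suc m) j<s =
  cong₂ _+_ (cong g (setBlock-miss w b (>⇒≢ j<s)))
            (blockSum-setBlock-below g b j w (suc s) m (m<n⇒m<1+n j<s))

blockSum-setBlock : ∀ g b j w s m c → s ≤ j → j < s + m → g w ≡ g (b j) + c →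
                    blockSum g (setBlock j w b) s m ≡ blockSum g b s m + c
blockSum-setBlock g b j w s zero c s≤j j<s _ rewrite +-identityʳ s =
  ⊥-elim (<-irrefl refl (<-≤-trans j<s s≤j))
blockSum-setBlock g b j w s (suc m) c s≤j j<s+m gw with m≤n⇒m<n∨m≡n s≤j
... | inj₂ refl = begin
  g (setBlock s w b s) + blockSum g (setBlock s w b) (suc s) m
    ≡⟨ cong₂ _+_ (cong g (setBlock-hit s w b)) (blockSum-setBlock-below g b s w (suc s) m ≤-refl) ⟩
  g w + blockSum g b (suc s) m                ≡⟨ cong (_+ blockSum g b (suc s) m) gw ⟩
  g (b s) + c + blockSum g b (suc s) m        ≡⟨ +-assoc (g (b s)) c _ ⟩
  g (b s) + (c + blockSum g b (suc s) m)      ≡⟨ cong (g (b s) +_) (+-comm c _) ⟩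
  g (b s) + (blockSum g b (suc s) m + c)      ≡⟨ sym (+-assoc (g (b s)) _ c) ⟩
  g (b s) + blockSum g b (suc s) m + c        ∎
  where open ≡-Reasoning
... | inj₁ s<j = begin
  g (setBlock j w b s) + blockSum g (setBlock j w b) (suc s) m
    ≡⟨ cong (_+ blockSum g (setBlock j w b) (suc s) m) (cong g (setBlock-miss w b (<⇒≢ s<j))) ⟩
  g (b s) + blockSum g (setBlock j w b) (suc s) m
    ≡⟨ cong (g (b s) +_) (blockSum-setBlock g b j w (suc s) m c s<j
                            (subst (j <_) (+-suc s m) j<s+m) gw) ⟩
  g (b s) + (blockSum g b (suc s) m + c)      ≡⟨ sym (+-assoc (g (b s)) _ c) ⟩
  g (b s) + blockSum g b (suc s) m + c        ∎
  where open ≡-Reasoning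

length-concatBlocks-setBlock : ∀ n b j w c → j < n → length w ≡ length (b j) + c →
                               length (concatBlocks n (setBlock j w b)) ≡ length (concatBlocks n b) + c
length-concatBlocks-setBlock n b j w c j<n lw = begin
  length (concatBlocks n (setBlock j w b))  ≡⟨ length-concatBlocks n (setBlock j w b) ⟩
  blockSum length (setBlock j w b) 0 n      ≡⟨ blockSum-setBlock length b j w 0 n c z≤n j<n lw ⟩
  blockSum length b 0 n + c                 ≡⟨ cong (_+ c) (sym (length-concatBlocks n b)) ⟩
  length (concatBlocks n b) + c             ∎
  where open ≡-Reasoning

-- Well-formed blocks and the statistics read off their concatenation

data WellFormed (i : ℕ) : List ℕ → Set where
  empty  : WellFormed i []
  opened : ∀ {w} → All (λ x → x ≡ 0 ⊎ x ≡ i) w → WellFormed i (i ∷ w)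

Shaped : Blocks → Set
Shaped b = ∀ i → WellFormed (suc i) (b (suc i))

wellFormed-snoc : ∀ {i w x} → WellFormed i w → w ≢ [] → x ≡ 0 ⊎ x ≡ i → WellFormed i (w ++ [ x ])
wellFormed-snoc empty w≢[] _ = ⊥-elim (w≢[] refl)
wellFormed-snoc (opened xs) _ x∈ = opened (++⁺ xs (x∈ ∷ []))

-- Number of zero entries; summed over positive blocks it counts late zeros.
zeros : List ℕ → ℕ
zeros [] = 0
zeros (zero ∷ w) = suc (zeros w)
zeros (suc _ ∷ w) = zeros w

zeros-++ : ∀ w v → zeros (w ++ v) ≡ zeros w + zeros v
zeros-++ [] v = refl
zeros-++ (zero ∷ w) v = cong suc (zeros-++ w v)
zeros-++ (suc _ ∷ w) v = zeros-++ w v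

-- 1 for a nonempty block; summed over positive blocks it counts distinct nonzero values.
nonEmpty : List ℕ → ℕ
nonEmpty [] = 0
nonEmpty (_ ∷ _) = 1

nonEmpty-++ : ∀ w v → w ≢ [] → nonEmpty (w ++ v) ≡ nonEmpty w
nonEmpty-++ [] v w≢[] = ⊥-elim (w≢[] refl)
nonEmpty-++ (_ ∷ _) v _ = refl

lateZeros-seen : ∀ w R → lateZerosFrom true (w ++ R) ≡ zeros w + lateZerosFrom true R
lateZeros-seen [] R = refl
lateZeros-seen (zero ∷ w) R = cong suc (lateZeros-seen w R)
lateZeros-seen (suc _ ∷ w) R = lateZeros-seen w R

lateZeros-block : ∀ {i blk} R X flag → WellFormed (suc i) blk → (∀ f → lateZerosFrom f R ≡ X) →
                  lateZerosFrom flag (blk ++ R) ≡ zeros blk + X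
lateZeros-block R X flag empty R≡X = R≡X flag
lateZeros-block R X false (opened {w} _) R≡X = trans (lateZeros-seen w R) (cong (zeros w +_) (R≡X true))
lateZeros-block R X true (opened {w} _) R≡X = trans (lateZeros-seen w R) (cong (zeros w +_) (R≡X true))

lateZeros-blocks : ∀ b → Shaped b → ∀ s m flag →
                   lateZerosFrom flag (concatMap b (range (suc s) m)) ≡ blockSum zeros b (suc s) m
lateZeros-blocks b sh s zero flag = refl
lateZeros-blocks b sh s (suc m) flag =
  lateZeros-block _ _ flag (sh s) (lateZeros-blocks b sh (suc s) m)

nonzero? : (x : ℕ) → _
nonzero? x = ¬? (x ≟ 0)

dedup : List ℕ → List ℕ
dedup = deduplicate _≟_

filter-run : ∀ {i} w → All (λ x → x ≡ 0 ⊎ x ≡ suc i) w →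
             Σ ℕ (λ c → filter nonzero? w ≡ replicate c (suc i))
filter-run [] [] = 0 , refl
filter-run (.0 ∷ w) (inj₁ refl ∷ xs) = filter-run w xs
filter-run {i} (.(suc i) ∷ w) (inj₂ refl ∷ xs) with filter-run w xs
... | c , eq = suc c , cong (suc i ∷_) eq

dedup-run : ∀ c x T → All (x ≢_) T → dedup (x ∷ replicate c x ++ T) ≡ x ∷ dedup T
dedup-run zero x T x∉T = cong (x ∷_) (filter-all (λ y → ¬? (x ≟ y)) (deduplicate⁺ _≟_ x∉T))
dedup-run (suc c) x T x∉T = trans twice (dedup-run c x T x∉T)
  where
  twice : dedup (x ∷ x ∷ replicate c x ++ T) ≡ dedup (x ∷ replicate c x ++ T)
  twice = cong (x ∷_) (trans (filter-reject (λ y → ¬? (x ≟ y)) (λ x≢x → x≢x refl))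
                             (filter-idem (λ y → ¬? (x ≟ y)) (dedup (replicate c x ++ T))))

block-bound : ∀ {i w} → WellFormed i w → All (λ y → y ≡ 0 ⊎ i ≤ y) w
block-bound empty = []
block-bound (opened xs) = inj₂ ≤-refl ∷ mapAll weaken xs
  where
  weaken : ∀ {i y} → y ≡ 0 ⊎ y ≡ i → y ≡ 0 ⊎ i ≤ y
  weaken (inj₁ y≡0) = inj₁ y≡0
  weaken (inj₂ refl) = inj₂ ≤-refl

blocks-bound : ∀ b → Shaped b → ∀ s m → All (λ y → y ≡ 0 ⊎ suc s ≤ y) (concatMap b (range (suc s) m))
blocks-bound b sh s zero = []
blocks-bound b sh s (suc m) = ++⁺ (block-bound (sh s)) (mapAll weaken (blocks-bound b sh (suc s) m))
  where
  weaken : ∀ {y} → y ≡ 0 ⊎ suc (suc s) ≤ y → y ≡ 0 ⊎ suc s ≤ y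
  weaken (inj₁ y≡0) = inj₁ y≡0
  weaken (inj₂ s<y) = inj₂ (<⇒≤ s<y)

values-block : ∀ {i} blk R → WellFormed (suc i) blk → All (suc i ≢_) (filter nonzero? R) →
               length (dedup (filter nonzero? (blk ++ R))) ≡ nonEmpty blk + length (dedup (filter nonzero? R))
values-block [] R empty _ = refl
values-block {i} (.(suc i) ∷ w) R (opened xs) i∉R with filter-run w xs
... | c , run = cong length (begin
  dedup (suc i ∷ filter nonzero? (w ++ R))
    ≡⟨ cong (dedup ∘ (suc i ∷_)) (filter-++ nonzero? w R) ⟩
  dedup (suc i ∷ filter nonzero? w ++ filter nonzero? R)
    ≡⟨ cong (λ u → dedup (suc i ∷ u ++ filter nonzero? R)) run ⟩
  dedup (suc i ∷ replicate c (suc i) ++ filter nonzero? R)  ≡⟨ dedup-run c (suc i) _ i∉R ⟩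
  suc i ∷ dedup (filter nonzero? R)                         ∎)
  where open ≡-Reasoning

values-blocks : ∀ b → Shaped b → ∀ s m →
                length (dedup (filter nonzero? (concatMap b (range (suc s) m)))) ≡ blockSum nonEmpty b (suc s) m
values-blocks b sh s zero = refl
values-blocks b sh s (suc m) =
  trans (values-block (b (suc s)) _ (sh s) (filter⁺ nonzero? (mapAll later (blocks-bound b sh (suc s) m))))
        (cong (nonEmpty (b (suc s)) +_) (values-blocks b sh (suc s) m))
  where
  later : ∀ {y} → y ≡ 0 ⊎ suc (suc s) ≤ y → suc s ≢ y
  later (inj₁ refl) = λ ()
  later (inj₂ s<y) = <⇒≢ s<y

StartsNonzero : List ℕ → Set
StartsNonzero e = Σ ℕ (λ x → Σ (List ℕ) (λ r → (e ≡ x ∷ r) × (x ≢ 0)))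

head-block : ∀ {i} blk R → WellFormed (suc i) blk → R ≡ [] ⊎ StartsNonzero R →
             blk ++ R ≡ [] ⊎ StartsNonzero (blk ++ R)
head-block [] R empty hR = hR
head-block (_ ∷ w) R (opened _) _ = inj₂ (_ , _ , refl , λ ())

head-blocks : ∀ b → Shaped b → ∀ s m → let e = concatMap b (range (suc s) m) in e ≡ [] ⊎ StartsNonzero e
head-blocks b sh s zero = inj₁ refl
head-blocks b sh s (suc m) = head-block (b (suc s)) _ (sh s) (head-blocks b sh (suc s) m)

lateZeros-zeroRun : ∀ z R → lateZerosFrom false (replicate z 0 ++ R) ≡ lateZerosFrom false R
lateZeros-zeroRun zero R = refl
lateZeros-zeroRun (suc z) R = lateZeros-zeroRun z R

filter-zeroRun : ∀ z R → filter nonzero? (replicate z 0 ++ R) ≡ filter nonzero? R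
filter-zeroRun zero R = refl
filter-zeroRun (suc z) R = filter-zeroRun z R

replicate-snoc : ∀ z (x : ℕ) → replicate z x ++ [ x ] ≡ replicate (suc z) x
replicate-snoc zero x = refl
replicate-snoc (suc z) x = cong (x ∷_) (replicate-snoc z x)

take-replicate-++ : ∀ z (x : ℕ) R → take z (replicate z x ++ R) ≡ replicate z x
take-replicate-++ zero x R = refl
take-replicate-++ (suc z) x R = cong (x ∷_) (take-replicate-++ z x R)

drop-replicate-++ : ∀ z (x : ℕ) R → drop z (replicate z x ++ R) ≡ R
drop-replicate-++ zero x R = refl
drop-replicate-++ (suc z) x R = drop-replicate-++ z x R

-- Letters of the valley word other than D; each of them adds one entry to e.
entryLetters : List VLetter → ℕ
entryLetters [] = 0
entryLetters (vD ∷ w) = entryLetters w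
entryLetters (vU ∷ w) = suc (entryLetters w)
entryLetters (vV ∷ w) = suc (entryLetters w)
entryLetters (vF ∷ w) = suc (entryLetters w)

-- Each entry letter spans width 2 (U and the D matched with it, V = DU, F), so for a
-- path from height h to h', twice their number plus h is the width plus h'.
entryLetters-width : ∀ s h h' → walk h s ≡ just h' →
                     entryLetters (valleyWord s) + entryLetters (valleyWord s) + h ≡ width s + h'
entryLetters-width [] h .h refl = refl
entryLetters-width (U ∷ s) h h' w = cong suc (begin
  c + suc c + h    ≡⟨ cong (_+ h) (+-suc c c) ⟩
  suc (c + c + h)  ≡⟨ sym (+-suc (c + c) h) ⟩
  c + c + suc h    ≡⟨ entryLetters-width s (suc h) h' w ⟩
  width s + h'     ∎)
  where open ≡-Reasoning
        c : ℕ
        c = entryLetters (valleyWord s)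
entryLetters-width (F ∷ s) h h' w =
  cong suc (trans (cong (_+ h) (+-suc c c)) (cong suc (entryLetters-width s h h' w)))
  where c : ℕ
        c = entryLetters (valleyWord s)
entryLetters-width (D ∷ []) (suc h) h' w = trans (+-suc 0 h) (cong suc (entryLetters-width [] h h' w))
entryLetters-width (D ∷ U ∷ s) (suc h) h' w =
  cong suc (trans (cong (_+ suc h) (+-suc c c)) (cong suc (entryLetters-width s (suc h) h' w)))
  where c : ℕ
        c = entryLetters (valleyWord s)
entryLetters-width (D ∷ D ∷ s) (suc h) h' w =
  trans (+-suc _ h) (cong suc (entryLetters-width (D ∷ s) h h' w))
entryLetters-width (D ∷ F ∷ s) (suc h) h' w =
  trans (+-suc _ h) (cong suc (entryLetters-width (F ∷ s) h h' w))

-- A Schröder n'-path has exactly n' entry letters: φ produces n' + 1 entries.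
entryLetters-schroeder : ∀ n' p → IsSchroeder n' p → entryLetters (valleyWord p) ≡ n'
entryLetters-schroeder n' p (wk , wd) = *-cancelˡ-≡ c n' 2 (begin
  2 * c           ≡⟨ cong (c +_) (+-identityʳ c) ⟩
  c + c           ≡⟨ sym (+-identityʳ (c + c)) ⟩
  c + c + 0       ≡⟨ entryLetters-width p 0 0 wk ⟩
  width p + 0     ≡⟨ +-identityʳ (width p) ⟩
  width p         ≡⟨ wd ⟩
  2 * n'          ∎)
  where open ≡-Reasoning
        c : ℕ
        c = entryLetters (valleyWord p)

module Simulation (n' : ℕ) where

  n : ℕ
  n = suc n'

  lateZerosOf valuesOf : Blocks → ℕ
  lateZerosOf b = blockSum zeros b 1 n'
  valuesOf b = blockSum nonEmpty b 1 n'

  record Invariant (L z : ℕ) (b : Blocks) : Set where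
    field
      zeroBlock  : b 0 ≡ replicate (suc z) 0
      shaped     : Shaped b
      emptyFrom  : ∀ i → L ≤ i → b i ≡ []
      lengthIs   : length (concatBlocks n b) ≡ L
  open Invariant

  data Stack (b : Blocks) : ℕ → List ℕ → Set where
    base : Stack b 0 (0 ∷ [])
    push : ∀ {h j M} → b (suc j) ≢ [] → Stack b h M → Stack b (suc h) (suc j ∷ M)

  stack-grows : ∀ {b b' h M} → Grows b b' → Stack b h M → Stack b' h M
  stack-grows g base = base
  stack-grows g (push bj st) = push (g _ bj) (stack-grows g st)

  -- Block b₀ is never empty, so e is never empty.
  length-nonzero : ∀ {z b} → ¬ Invariant 0 z b
  length-nonzero I with trans (sym (emptyFrom I 0 z≤n)) (zeroBlock I)
  ... | ()

  nonempty-below : ∀ {L z b j} → Invariant L z b → b j ≢ [] → j < L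
  nonempty-below I bj≢[] = ≰⇒> (λ L≤j → bj≢[] (emptyFrom I _ L≤j))

  length-grows : ∀ {L z b} → Invariant L z b → ∀ j w → j < n → length w ≡ length (b j) + 1 →
                 length (concatBlocks n (setBlock j w b)) ≡ suc L
  length-grows {L} {b = b} I j w j<n lw = begin
    length (concatBlocks n (setBlock j w b))  ≡⟨ length-concatBlocks-setBlock n b j w 1 j<n lw ⟩
    length (concatBlocks n b) + 1             ≡⟨ cong (_+ 1) (lengthIs I) ⟩
    L + 1                                     ≡⟨ +-comm L 1 ⟩
    suc L                                     ∎
    where open ≡-Reasoning

  record Effect (L z : ℕ) (b : Blocks) (z' : ℕ) (b' : Blocks) (dZ dV : ℕ) : Set where
    field
      invariant   : Invariant (suc L) z' b'
      lateZerosBy : lateZerosOf b' ≡ lateZerosOf b + dZ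
      valuesBy    : valuesOf b' ≡ valuesOf b + dV
  open Effect

  openBlock : ∀ {ℓ z b} → Invariant (suc ℓ) z b → suc ℓ < n →
              Effect (suc ℓ) z b z (setBlock (suc ℓ) [ suc ℓ ] b) 0 1
  openBlock {ℓ} {z} {b} I ℓ<n = record
    { invariant = record
      { zeroBlock = trans (setBlock-miss {0} {suc ℓ} w b (λ ())) (zeroBlock I)
      ; shaped = shaped′
      ; emptyFrom = λ i L<i → trans (setBlock-miss w b (>⇒≢ L<i)) (emptyFrom I i (<⇒≤ L<i))
      ; lengthIs = length-grows I (suc ℓ) w ℓ<n (fromEmpty length 1 refl) }
    ; lateZerosBy = blockSum-setBlock zeros b (suc ℓ) w 1 n' 0 (s≤s z≤n) ℓ<n (fromEmpty zeros 0 refl)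
    ; valuesBy = blockSum-setBlock nonEmpty b (suc ℓ) w 1 n' 1 (s≤s z≤n) ℓ<n (fromEmpty nonEmpty 1 refl) }
    where
    w : List ℕ
    w = [ suc ℓ ]
    fresh : b (suc ℓ) ≡ []
    fresh = emptyFrom I (suc ℓ) ≤-refl
    fromEmpty : ∀ g c → g w ≡ g [] + c → g w ≡ g (b (suc ℓ)) + c
    fromEmpty g c gw = trans gw (cong (λ u → g u + c) (sym fresh))
    shaped′ : Shaped (setBlock (suc ℓ) w b)
    shaped′ i with i ≟ ℓ
    ... | yes refl = subst (WellFormed (suc i)) (sym (setBlock-hit (suc i) w b)) (opened [])
    ... | no i≢ℓ = subst (WellFormed (suc i)) (sym (setBlock-miss w b (i≢ℓ ∘ suc-injective))) (shaped I i)

  appendPositive : ∀ {L z b j x} → Invariant L z b → L < n → b (suc j) ≢ [] → x ≡ 0 ⊎ x ≡ suc j →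
                   Effect L z b z (appendBlock (suc j) x b) (zeros [ x ]) 0
  appendPositive {L} {z} {b} {j} {x} I L<n bj≢[] x∈ = record
    { invariant = record
      { zeroBlock = trans (setBlock-miss {0} {suc j} w b (λ ())) (zeroBlock I)
      ; shaped = shaped′
      ; emptyFrom = λ i L<i → trans (setBlock-miss w b (>⇒≢ (<-trans j<L L<i))) (emptyFrom I i (<⇒≤ L<i))
      ; lengthIs = length-grows I (suc j) w j<n (length-++ (b (suc j))) }
    ; lateZerosBy = blockSum-setBlock zeros b (suc j) w 1 n' (zeros [ x ]) (s≤s z≤n) j<n
                                     (zeros-++ (b (suc j)) [ x ])
    ; valuesBy = blockSum-setBlock nonEmpty b (suc j) w 1 n' 0 (s≤s z≤n) j<n
                                   (trans (nonEmpty-++ (b (suc j)) [ x ] bj≢[]) (sym (+-identityʳ _))) }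
    where
    w : List ℕ
    w = b (suc j) ++ [ x ]
    j<L : suc j < L
    j<L = nonempty-below I bj≢[]
    j<n : suc j < n
    j<n = <-trans j<L L<n
    shaped′ : Shaped (appendBlock (suc j) x b)
    shaped′ i with i ≟ j
    ... | yes refl = subst (WellFormed (suc i)) (sym (setBlock-hit (suc i) w b))
                           (wellFormed-snoc (shaped I i) bj≢[] x∈)
    ... | no i≢j = subst (WellFormed (suc i)) (sym (setBlock-miss w b (i≢j ∘ suc-injective))) (shaped I i)

  appendZero : ∀ {L z b} → Invariant L z b → L < n → Effect L z b (suc z) (appendBlock 0 0 b) 0 0
  appendZero {L} {z} {b} I L<n = record
    { invariant = record
      { zeroBlock = trans (setBlock-hit 0 w b) (trans (cong (_++ [ 0 ]) (zeroBlock I)) (replicate-snoc (suc z) 0))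
      ; shaped = λ i → subst (WellFormed (suc i)) (sym (setBlock-miss {suc i} {0} w b (λ ()))) (shaped I i)
      ; emptyFrom = emptyFrom′
      ; lengthIs = length-grows I 0 w (s≤s z≤n) (length-++ (b 0)) }
    ; lateZerosBy = untouched zeros
    ; valuesBy = untouched nonEmpty }
    where
    w : List ℕ
    w = b 0 ++ [ 0 ]
    untouched : ∀ g → blockSum g (appendBlock 0 0 b) 1 n' ≡ blockSum g b 1 n' + 0
    untouched g = trans (blockSum-setBlock-below g b 0 w 1 n' (s≤s z≤n)) (sym (+-identityʳ _))
    emptyFrom′ : ∀ i → suc L ≤ i → appendBlock 0 0 b i ≡ []
    emptyFrom′ (suc i) L<i = trans (setBlock-miss {suc i} {0} w b (λ ())) (emptyFrom I (suc i) (<⇒≤ L<i))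

  record Outcome (b : Blocks) (f tZ tV : ℕ) (b' : Blocks) : Set where
    field
      shapedEnd     : Shaped b'
      zeroBlockEnd  : b' 0 ≡ replicate (suc f) 0
      lengthEnd     : length (concatBlocks n b') ≡ n
      lateZerosEnd  : lateZerosOf b' ≡ lateZerosOf b + tZ
      valuesEnd     : valuesOf b' ≡ valuesOf b + tV
  open Outcome

  after : ∀ {L z b z' b' dZ dV f f' tZ tZ' tV tV' bF} → Effect L z b z' b' dZ dV →
          Outcome b' f' tZ' tV' bF → f' ≡ f → tZ ≡ dZ + tZ' → tV ≡ dV + tV' → Outcome b f tZ tV bF
  after E O f'≡f tZ≡ tV≡ = record
    { shapedEnd = shapedEnd O
    ; zeroBlockEnd = trans (zeroBlockEnd O) (cong (λ k → replicate (suc k) 0) f'≡f)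
    ; lengthEnd = lengthEnd O
    ; lateZerosEnd = accumulate (lateZerosEnd O) (lateZerosBy E) tZ≡
    ; valuesEnd = accumulate (valuesEnd O) (valuesBy E) tV≡ }
    where
    accumulate : ∀ {total mid start d t t'} → total ≡ mid + t' → mid ≡ start + d → t ≡ d + t' →
                 total ≡ start + t
    accumulate {total} {mid} {start} {d} {t} {t'} total≡ mid≡ t≡ = begin
      total             ≡⟨ total≡ ⟩
      mid + t'          ≡⟨ cong (_+ t') mid≡ ⟩
      start + d + t'    ≡⟨ +-assoc start d t' ⟩
      start + (d + t')  ≡⟨ cong (start +_) (sym t≡) ⟩
      start + t         ∎
      where open ≡-Reasoning

  -- The current length plus the entry letters still to come is n; so while an entry
  -- letter remains, the current length is below n and the next entry fits.
  fits-next : ∀ L {c} → L + suc c ≡ n → suc L + c ≡ n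
  fits-next L {c} fits = trans (sym (+-suc L c)) fits

  room : ∀ {L c} → L + suc c ≡ n → L < n
  room {L} fits = subst (L <_) fits (m<m+n L (s≤s z≤n))

  run : ∀ s h L z b M → Invariant L z b → Stack b h M → walk h s ≡ just 0 →
        L + entryLetters (valleyWord s) ≡ n →
        Outcome b (z + flats0From h s) (valleys s) (countU (valleyWord s)) (phiRun n (valleyWord s) b M)
  run [] zero L z b M I _ refl fits = record
    { shapedEnd = shaped I
    ; zeroBlockEnd = trans (zeroBlock I) (cong (λ k → replicate (suc k) 0) (sym (+-identityʳ z)))
    ; lengthEnd = trans (lengthIs I) (trans (sym (+-identityʳ L)) fits)
    ; lateZerosEnd = sym (+-identityʳ _)
    ; valuesEnd = sym (+-identityʳ _) }
  run (U ∷ s) h zero z b M I _ _ _ = ⊥-elim (length-nonzero I)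
  run (U ∷ s) h (suc ℓ) z b M I st w fits rewrite lengthIs I =
    after E (run s (suc h) (suc (suc ℓ)) z _ (suc ℓ ∷ M) (invariant E) (push newBlock st′) w
                 (fits-next (suc ℓ) fits))
          refl refl refl
    where
    E : Effect (suc ℓ) z b z (setBlock (suc ℓ) [ suc ℓ ] b) 0 1
    E = openBlock I (room fits)
    newBlock : setBlock (suc ℓ) [ suc ℓ ] b (suc ℓ) ≢ []
    newBlock = subst (_≢ []) (sym (setBlock-hit (suc ℓ) [ suc ℓ ] b)) (λ ())
    st′ : Stack (setBlock (suc ℓ) [ suc ℓ ] b) h M
    st′ = stack-grows (setBlock-grows (suc ℓ) [ suc ℓ ] b (λ ())) st
  run (F ∷ s) zero L z b .(0 ∷ []) I base w fits =
    after E (run s zero (suc L) (suc z) _ (0 ∷ []) (invariant E) base w (fits-next L fits))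
          (sym (+-suc z _)) refl refl
    where E : Effect L z b (suc z) (appendBlock 0 0 b) 0 0
          E = appendZero I (room fits)
  run (F ∷ s) (suc h) L z b (suc j ∷ M) I st@(push bj _) w fits =
    after E (run s (suc h) (suc L) z _ (suc j ∷ M) (invariant E) st′ w (fits-next L fits)) refl refl refl
    where E : Effect L z b z (appendBlock (suc j) (suc j) b) 0 0
          E = appendPositive I (room fits) bj (inj₂ refl)
          st′ : Stack (appendBlock (suc j) (suc j) b) (suc h) (suc j ∷ M)
          st′ = stack-grows (appendBlock-grows (suc j) (suc j) b) st
  run (D ∷ U ∷ s) (suc h) L z b (suc j ∷ M) I st@(push bj _) w fits =
    after E (run s (suc h) (suc L) z _ (suc j ∷ M) (invariant E) st′ w (fits-next L fits)) refl refl refl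
    where E : Effect L z b z (appendBlock (suc j) 0 b) 1 0
          E = appendPositive I (room fits) bj (inj₁ refl)
          st′ : Stack (appendBlock (suc j) 0 b) (suc h) (suc j ∷ M)
          st′ = stack-grows (appendBlock-grows (suc j) 0 b) st
  run (D ∷ []) (suc h) L z b (_ ∷ M) I (push _ st) w fits = run [] h L z b M I st w fits
  run (D ∷ D ∷ s) (suc h) L z b (_ ∷ M) I (push _ st) w fits = run (D ∷ s) h L z b M I st w fits
  run (D ∷ F ∷ s) (suc h) L z b (_ ∷ M) I (push _ st) w fits = run (F ∷ s) h L z b M I st w fits

blockSum-initBlocks : ∀ g → g [] ≡ 0 → ∀ s m → blockSum g initBlocks (suc s) m ≡ 0
blockSum-initBlocks g g[]≡0 s zero = refl
blockSum-initBlocks g g[]≡0 s (suc m) = cong₂ _+_ g[]≡0 (blockSum-initBlocks g g[]≡0 (suc s) m)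

record Shape (n' : ℕ) (p : List Step) : Set where
  field
    blocks        : Blocks
    shapedBlocks  : Shaped blocks
    decomposition : phi (suc n') p ≡ replicate (suc (flats0 p)) 0 ++ concatMap blocks (range 1 n')
    lengthPhi     : length (phi (suc n') p) ≡ suc n'
    blockZeros    : blockSum zeros blocks 1 n' ≡ valleys p
    blockValues   : blockSum nonEmpty blocks 1 n' ≡ countU (valleyWord p)

shape : ∀ n' p → IsSchroeder n' p → Shape n' p
shape n' p sch@(wk , _) = record
  { blocks = final
  ; shapedBlocks = shapedEnd O
  ; decomposition = trans (concatBlocks-suc n' final) (cong (_++ concatMap final (range 1 n')) (zeroBlockEnd O))
  ; lengthPhi = lengthEnd O
  ; blockZeros = trans (lateZerosEnd O) (cong (_+ valleys p) (blockSum-initBlocks zeros refl 0 n'))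
  ; blockValues = trans (valuesEnd O) (cong (_+ countU (valleyWord p)) (blockSum-initBlocks nonEmpty refl 0 n')) }
  where
  open Simulation n'
  open Outcome
  final : Blocks
  final = phiRun (suc n') (valleyWord p) initBlocks (0 ∷ [])
  initial : Invariant 1 0 initBlocks
  initial = record
    { zeroBlock = refl
    ; shaped = λ _ → empty
    ; emptyFrom = λ { (suc i) _ → refl }
    ; lengthIs = trans (length-concatBlocks (suc n') initBlocks)
                       (cong suc (blockSum-initBlocks length refl 0 n')) }
  O : Outcome initBlocks (flats0 p) (valleys p) (countU (valleyWord p)) final
  O = run p 0 1 0 initBlocks (0 ∷ []) initial base wk (cong suc (entryLetters-schroeder n' p sch))

lateZeros-phi : ∀ {n' p} → Shape n' p → lateZeros (phi (suc n') p) ≡ valleys p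
lateZeros-phi {n'} {p} S = begin
  lateZeros (phi (suc n') p)                                     ≡⟨ cong lateZeros decomposition ⟩
  lateZerosFrom false (replicate (suc (flats0 p)) 0 ++ rest)     ≡⟨ lateZeros-zeroRun (suc (flats0 p)) rest ⟩
  lateZerosFrom false rest                                       ≡⟨ lateZeros-blocks blocks shapedBlocks 0 n' false ⟩
  blockSum zeros blocks 1 n'                                     ≡⟨ blockZeros ⟩
  valleys p                                                      ∎
  where open Shape S
        open ≡-Reasoning
        rest : List ℕ
        rest = concatMap blocks (range 1 n')

distinctNonzero-phi : ∀ {n' p} → Shape n' p → distinctNonzero (phi (suc n') p) ≡ countU (valleyWord p)
distinctNonzero-phi {n'} {p} S = begin
  distinctNonzero (phi (suc n') p)                     ≡⟨ cong distinctNonzero decomposition ⟩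
  values (replicate (suc (flats0 p)) 0 ++ rest)
    ≡⟨ cong (length ∘ dedup) (filter-zeroRun (suc (flats0 p)) rest) ⟩
  values rest                                          ≡⟨ values-blocks blocks shapedBlocks 0 n' ⟩
  blockSum nonEmpty blocks 1 n'                        ≡⟨ blockValues ⟩
  countU (valleyWord p)                                ∎
  where open Shape S
        open ≡-Reasoning
        rest : List ℕ
        rest = concatMap blocks (range 1 n')
        values : List ℕ → ℕ
        values e = length (dedup (filter nonzero? e))

zeroPrefix-phi : ∀ {n' p} → Shape n' p → let f = suc (flats0 p) in
                 (take f (phi (suc n') p) ≡ replicate f 0) × (f ≡ suc n' ⊎ StartsNonzero (drop f (phi (suc n') p)))
zeroPrefix-phi {n'} {p} S = prefix , after-prefix (head-blocks blocks shapedBlocks 0 n')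
  where
  open Shape S
  open ≡-Reasoning
  f : ℕ
  f = suc (flats0 p)
  rest : List ℕ
  rest = concatMap blocks (range 1 n')
  prefix : take f (phi (suc n') p) ≡ replicate f 0
  prefix = trans (cong (take f) decomposition) (take-replicate-++ f 0 rest)
  dropped : drop f (phi (suc n') p) ≡ rest
  dropped = trans (cong (drop f) decomposition) (drop-replicate-++ f 0 rest)
  after-prefix : rest ≡ [] ⊎ StartsNonzero rest → f ≡ suc n' ⊎ StartsNonzero (drop f (phi (suc n') p))
  after-prefix (inj₂ nonzero) = inj₂ (subst StartsNonzero (sym dropped) nonzero)
  after-prefix (inj₁ rest≡[]) = inj₁ (begin
    f                                   ≡⟨ sym (length-replicate f) ⟩
    length (replicate f 0)              ≡⟨ cong length (sym (++-identityʳ (replicate f 0))) ⟩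
    length (replicate f 0 ++ [])        ≡⟨ cong (λ r → length (replicate f 0 ++ r)) (sym rest≡[]) ⟩
    length (replicate f 0 ++ rest)      ≡⟨ cong length (sym decomposition) ⟩
    length (phi (suc n') p)             ≡⟨ lengthPhi ⟩
    suc n'                              ∎)

corollary3 : (n : ℕ) → 1 ≤ n → (p : List Step) → IsSchroeder (n ∸ 1) p → (k : ℕ) →
    ((valleys p ≡ k → lateZeros (phi n p) ≡ k)
    × (countU (valleyWord p) ≡ k → distinctNonzero (phi n p) ≡ k)
    × (flats0 p ≡ k →
        (take (suc k) (phi n p) ≡ replicate (suc k) 0)
        × ((suc k ≡ n) ⊎ Σ ℕ (λ x → Σ (List ℕ) (λ r → (drop (suc k) (phi n p) ≡ x ∷ r) × (x ≢ 0))))))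
corollary3 zero () p _ k
corollary3 (suc n') _ p sch k =
  (λ { refl → lateZeros-phi S }) , (λ { refl → distinctNonzero-phi S }) , (λ { refl → zeroPrefix-phi S })
  where S : Shape n' p
        S = shape n' p sch
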